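{- For any permutation $\alpha$ and any integer $b\ge0$, $\operatorname{diam}(G_{12[\alpha,\iota_b]})=\operatorname{diam}(G_{12[\iota_b,\alpha]})=\operatorname{diam}(G_\alpha)$, where $\iota_b=12\cdots b$.
   Context: For $\alpha\in\mathfrak S_a,\beta\in\mathfrak S_b$, $12[\alpha,\beta]=\alpha_1\cdots\alpha_a(\beta_1+a)\cdots(\beta_b+a)$; $\iota_0$ is the empty permutation. $R(\pi)$ is the set of reduced words of $\pi\in\mathfrak S_n$ (minimal-length words $r_1\cdots r_\ell$ in $[n-1]$ with $\pi=s_{r_1}\cdots s_{r_\ell}$, $s_i=(i,i+1)$); $G_\pi$ is the graph on $R(\pi)$ whose edges join words related by one commutation move (exchange adjacent $jk$, $|j-k|>1$) or one long braid move (consecutive $j(j+1)j\leftrightarrow(j+1)j(j+1)$). Diameter = maximum distance between two vertices (one-vertex graph: $0$). -}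

module Defs where

open import Data.Nat using (ℕ; zero; suc; _+_; _≤_; _<_; ∣_-_∣)
open import Data.List using (List; []; _∷_; _++_; map; length; foldl; upTo)
open import Data.List.Relation.Unary.All using (All)
open import Data.List.Relation.Binary.Permutation.Propositional using (_↭_)
open import Data.Product using (_×_; ∃; ∃-syntax; Σ-syntax)
open import Relation.Binary.PropositionalEquality using (_≡_)

-- Permutations of [n] in one-line notation (1-based): a list of naturals.
-- ι n = 1 2 ⋯ n (the identity of 𝔖_n); ι 0 is the empty permutation.
ι : ℕ → List ℕ
ι n = map suc (upTo n)

IsPerm : List ℕ → Set
IsPerm π = π ↭ ι (length π)

-- 12[α,β] = α₁⋯α_a (β₁+a)⋯(β_b+a), with a = length α
_⊕_ : List ℕ → List ℕ → List ℕ
α ⊕ β = α ++ map (_+ length α) β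

-- swap positions i and i+1 (1-based) of a one-line notation; i.e. π ↦ π s_i
swapAt : ℕ → List ℕ → List ℕ
swapAt zero xs = xs
swapAt (suc zero) (x ∷ y ∷ xs) = y ∷ x ∷ xs
swapAt (suc zero) xs = xs
swapAt (suc (suc i)) [] = []
swapAt (suc (suc i)) (x ∷ xs) = x ∷ swapAt (suc i) xs

-- the permutation s_{r₁} s_{r₂} ⋯ s_{r_ℓ} of [n], in one-line notation
evalWord : ℕ → List ℕ → List ℕ
evalWord n w = foldl (λ π r → swapAt r π) (ι n) w

ValidWord : ℕ → List ℕ → Set
ValidWord n w = All (λ r → 1 ≤ r × r < n) w

IsWord : List ℕ → List ℕ → Set
IsWord π w = ValidWord (length π) w × evalWord (length π) w ≡ π

Reduced : List ℕ → List ℕ → Set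
Reduced π w = IsWord π w × (∀ v → IsWord π v → length w ≤ length v)

data Move : List ℕ → List ℕ → Set where
  comm   : ∀ p q j k → 1 < ∣ j - k ∣ →
           Move (p ++ j ∷ k ∷ q) (p ++ k ∷ j ∷ q)
  braidL : ∀ p q j → Move (p ++ j ∷ suc j ∷ j ∷ q) (p ++ suc j ∷ j ∷ suc j ∷ q)
  braidR : ∀ p q j → Move (p ++ suc j ∷ j ∷ suc j ∷ q) (p ++ j ∷ suc j ∷ j ∷ q)

-- walks of length k in the graph G_π (vertices R(π), edges = moves)
data Walk (π : List ℕ) : List ℕ → List ℕ → ℕ → Set where
  here : ∀ {u} → Walk π u u 0
  step : ∀ {u v w k} → Reduced π u → Reduced π v → Move u v →
         Walk π v w k → Walk π u w (suc k)

-- diam(G_π) = d  (max over pairs of vertices of their distance);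
-- no d satisfies this if G_π were disconnected
HasDiameter : List ℕ → ℕ → Set
HasDiameter π d =
  (∀ u v → Reduced π u → Reduced π v → ∃[ k ] (k ≤ d × Walk π u v k)) ×
  (∃[ u ] ∃[ v ] (Reduced π u × Reduced π v × (∀ k → Walk π u v k → d ≤ k)))

-- Let a word act on an arrangement of values and record only the swaps that exchange two
-- values satisfying a predicate p: this restricted word, no longer than the original, sorts
-- the p-values of the start arrangement into the p-values of the end arrangement.
-- Restricting to the values of α turns any word for α ⊕ ι b (or ι b ⊕ α) into a word for α.
-- A reduced word therefore loses no letter under restriction, which confines every letter to
-- the α-block. So the reduced words of α ⊕ ι b are those of α, and those of ι b ⊕ α are those
-- of α with every letter shifted by b; commutation and braid moves correspond, and the graphs
-- are isomorphic.
module Submission where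

open import Defs
open import Data.Nat using (ℕ; zero; suc; _+_; _≤_; _<_; z≤n; s≤s; ∣_-_∣; _≤ᵇ_; _<ᵇ_)
open import Data.Nat.Properties
open import Data.Bool using (Bool; true; false; T; if_then_else_; _∧_)
open import Data.Unit using (tt)
open import Data.Maybe using (Maybe; just; nothing)
import Data.Maybe as Maybe
open import Data.List using (List; []; _∷_; _++_; map; length; foldl; applyUpTo; upTo)
open import Data.List.Properties
  using (map-++; length-map; length-++; length-upTo; map-upTo; map-∘; map-cong; map-injective;
         ++-cancelˡ; ++-cancelʳ; ++-identityʳ; ∷-injectiveˡ; ∷-injectiveʳ)
open import Data.List.Relation.Unary.All using (All; []; _∷_)
import Data.List.Relation.Unary.All as All
open import Data.List.Relation.Unary.All.Properties using (map⁺; applyUpTo⁺₁)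
open import Data.List.Relation.Binary.Permutation.Propositional using (↭-sym)
open import Data.List.Relation.Binary.Permutation.Propositional.Properties using (All-resp-↭)
open import Data.Product using (_×_; _,_; proj₂; ∃-syntax)
open import Data.Empty using (⊥-elim)
open import Function using (_∘_; id)
open import Function.Bundles using (_⇔_; mk⇔)
open import Relation.Nullary using (¬_)
open import Relation.Binary.PropositionalEquality

ValidWord-mono : ∀ {m n w} → m ≤ n → ValidWord m w → ValidWord n w
ValidWord-mono m≤n = All.map (λ (1≤r , r<m) → 1≤r , <-≤-trans r<m m≤n)

evalFrom : List ℕ → List ℕ → List ℕ
evalFrom σ w = foldl (λ π r → swapAt r π) σ w

length-swapAt : ∀ r xs → length (swapAt r xs) ≡ length xs
length-swapAt zero xs = refl
length-swapAt (suc zero) [] = refl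
length-swapAt (suc zero) (x ∷ []) = refl
length-swapAt (suc zero) (x ∷ y ∷ xs) = refl
length-swapAt (suc (suc i)) [] = refl
length-swapAt (suc (suc i)) (x ∷ xs) = cong suc (length-swapAt (suc i) xs)

swapAt-++ˡ : ∀ {r} xs ys → r < length xs → swapAt r (xs ++ ys) ≡ swapAt r xs ++ ys
swapAt-++ˡ {zero} xs ys _ = refl
swapAt-++ˡ {suc zero} (x ∷ y ∷ xs) ys _ = refl
swapAt-++ˡ {suc zero} (x ∷ []) ys (s≤s ())
swapAt-++ˡ {suc (suc i)} (x ∷ xs) ys (s≤s r<) = cong (x ∷_) (swapAt-++ˡ xs ys r<)

swapAt-++ʳ : ∀ r xs ys → swapAt (suc r + length xs) (xs ++ ys) ≡ xs ++ swapAt (suc r) ys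
swapAt-++ʳ r [] ys rewrite +-identityʳ r = refl
swapAt-++ʳ r (x ∷ xs) ys rewrite +-suc r (length xs) = cong (x ∷_) (swapAt-++ʳ r xs ys)

swapAt-map : ∀ (f : ℕ → ℕ) r xs → swapAt r (map f xs) ≡ map f (swapAt r xs)
swapAt-map f zero xs = refl
swapAt-map f (suc zero) [] = refl
swapAt-map f (suc zero) (x ∷ []) = refl
swapAt-map f (suc zero) (x ∷ y ∷ xs) = refl
swapAt-map f (suc (suc i)) [] = refl
swapAt-map f (suc (suc i)) (x ∷ xs) = cong (f x ∷_) (swapAt-map f (suc i) xs)

evalFrom-map : ∀ (f : ℕ → ℕ) σ w → evalFrom (map f σ) w ≡ map f (evalFrom σ w)
evalFrom-map f σ [] = refl
evalFrom-map f σ (r ∷ w) rewrite swapAt-map f r σ = evalFrom-map f (swapAt r σ) w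

evalFrom-++ˡ : ∀ xs ys w → ValidWord (length xs) w → evalFrom (xs ++ ys) w ≡ evalFrom xs w ++ ys
evalFrom-++ˡ xs ys [] _ = refl
evalFrom-++ˡ xs ys (r ∷ w) ((_ , r<) ∷ valid) rewrite swapAt-++ˡ xs ys r< =
  evalFrom-++ˡ (swapAt r xs) ys w (subst (λ n → ValidWord n w) (sym (length-swapAt r xs)) valid)

evalFrom-++ʳ : ∀ xs ys w → ValidWord (length ys) w →
  evalFrom (xs ++ ys) (map (_+ length xs) w) ≡ xs ++ evalFrom ys w
evalFrom-++ʳ xs ys [] _ = refl
evalFrom-++ʳ xs ys (suc r ∷ w) (_ ∷ valid) rewrite swapAt-++ʳ r xs ys =
  evalFrom-++ʳ xs (swapAt (suc r) ys) w
    (subst (λ n → ValidWord n w) (sym (length-swapAt (suc r) ys)) valid)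

applyUpTo-+ : ∀ (f : ℕ → ℕ) m n →
  applyUpTo f (m + n) ≡ applyUpTo f m ++ applyUpTo (f ∘ (m +_)) n
applyUpTo-+ f zero n = refl
applyUpTo-+ f (suc m) n = cong (f 0 ∷_) (applyUpTo-+ (f ∘ suc) m n)

upTo-+ : ∀ m n → upTo (m + n) ≡ upTo m ++ map (m +_) (upTo n)
upTo-+ m n = trans (applyUpTo-+ id m n) (cong (upTo m ++_) (sym (map-upTo (m +_) n)))

ι-+ : ∀ m n → ι (m + n) ≡ ι m ++ map (_+ m) (ι n)
ι-+ m n = begin
  ι (m + n)                               ≡⟨ cong (map suc) (upTo-+ m n) ⟩
  map suc (upTo m ++ map (m +_) (upTo n)) ≡⟨ map-++ suc (upTo m) _ ⟩
  ι m ++ map suc (map (m +_) (upTo n))    ≡⟨ cong (ι m ++_) (sym (map-∘ (upTo n))) ⟩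
  ι m ++ map (suc ∘ (m +_)) (upTo n)      ≡⟨ cong (ι m ++_) (map-cong (λ i → cong suc (+-comm m i)) (upTo n)) ⟩
  ι m ++ map ((_+ m) ∘ suc) (upTo n)      ≡⟨ cong (ι m ++_) (map-∘ (upTo n)) ⟩
  ι m ++ map (_+ m) (ι n)                 ∎
  where open ≡-Reasoning

length-ι : ∀ n → length (ι n) ≡ n
length-ι n = trans (length-map suc (upTo n)) (length-upTo n)

ι-bounds : ∀ n → All (λ x → 1 ≤ x × x ≤ n) (ι n)
ι-bounds n rewrite map-upTo suc n = applyUpTo⁺₁ suc n (λ i<n → s≤s z≤n , i<n)

IsPerm⇒bounds : ∀ {α} → IsPerm α → All (λ x → 1 ≤ x × x ≤ length α) α
IsPerm⇒bounds {α} perm = All-resp-↭ (↭-sym perm) (ι-bounds (length α))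

module Restriction (p : ℕ → Bool) where

  Dropped : List ℕ → Set
  Dropped = All (¬_ ∘ T ∘ p)

  -- This is filterᵇ p, but defined by if_then_else_ rather than by with, so that `with p x`
  -- in the proofs below also abstracts the occurrences of p x exposed only by unfolding.
  keep : List ℕ → List ℕ
  keep [] = []
  keep (x ∷ xs) = if p x then x ∷ keep xs else keep xs

  keep-++ : ∀ xs ys → keep (xs ++ ys) ≡ keep xs ++ keep ys
  keep-++ [] ys = refl
  keep-++ (x ∷ xs) ys with p x
  ... | true = cong (x ∷_) (keep-++ xs ys)
  ... | false = keep-++ xs ys

  keep-all : ∀ {xs} → All (T ∘ p) xs → keep xs ≡ xs
  keep-all [] = refl
  keep-all {x ∷ xs} (px ∷ pxs) with p x
  ... | true = cong (x ∷_) (keep-all pxs)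

  keep-none : ∀ {xs} → Dropped xs → keep xs ≡ []
  keep-none [] = refl
  keep-none {x ∷ xs} (¬px ∷ ¬pxs) with p x
  ... | true = ⊥-elim (¬px tt)
  ... | false = keep-none ¬pxs

  -- just k when the swap at r exchanges two kept values; k is the 0-based position in keep xs
  -- of the first of them, so the corresponding letter of the restricted word is suc k.
  restrictPosition : ℕ → List ℕ → Maybe ℕ
  restrictPosition zero xs = nothing
  restrictPosition (suc zero) (x ∷ y ∷ xs) = if p x ∧ p y then just 0 else nothing
  restrictPosition (suc zero) _ = nothing
  restrictPosition (suc (suc i)) [] = nothing
  restrictPosition (suc (suc i)) (x ∷ xs) =
    if p x then Maybe.map suc (restrictPosition (suc i) xs) else restrictPosition (suc i) xs

  keep-swapAt-kept : ∀ r xs {k} → restrictPosition r xs ≡ just k →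
    keep (swapAt r xs) ≡ swapAt (suc k) (keep xs)
  keep-swapAt-kept (suc zero) (x ∷ y ∷ xs) e with p x | p y
  keep-swapAt-kept (suc zero) (x ∷ y ∷ xs) refl | true | true = refl
  keep-swapAt-kept (suc zero) (x ∷ y ∷ xs) () | true | false
  keep-swapAt-kept (suc zero) (x ∷ y ∷ xs) () | false | _
  keep-swapAt-kept (suc (suc i)) (x ∷ xs) e with p x | restrictPosition (suc i) xs in e′
  keep-swapAt-kept (suc (suc i)) (x ∷ xs) refl | true | just k = cong (x ∷_) (keep-swapAt-kept (suc i) xs e′)
  keep-swapAt-kept (suc (suc i)) (x ∷ xs) e | false | _ = keep-swapAt-kept (suc i) xs (trans e′ e)

  keep-swapAt-dropped : ∀ r xs → restrictPosition r xs ≡ nothing → keep (swapAt r xs) ≡ keep xs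
  keep-swapAt-dropped zero xs e = refl
  keep-swapAt-dropped (suc zero) [] e = refl
  keep-swapAt-dropped (suc zero) (x ∷ []) e = refl
  keep-swapAt-dropped (suc zero) (x ∷ y ∷ xs) e with p x | p y
  keep-swapAt-dropped (suc zero) (x ∷ y ∷ xs) () | true | true
  ... | true | false = refl
  ... | false | true = refl
  ... | false | false = refl
  keep-swapAt-dropped (suc (suc i)) [] e = refl
  keep-swapAt-dropped (suc (suc i)) (x ∷ xs) e with p x | restrictPosition (suc i) xs in e′
  keep-swapAt-dropped (suc (suc i)) (x ∷ xs) () | true | just k
  ... | true | nothing = cong (x ∷_) (keep-swapAt-dropped (suc i) xs e′)
  ... | false | _ = keep-swapAt-dropped (suc i) xs (trans e′ e)

  restrictPosition-valid : ∀ r xs {k} → restrictPosition r xs ≡ just k → 1 ≤ r × r < length xs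
  restrictPosition-valid (suc zero) (x ∷ y ∷ xs) e = s≤s z≤n , s≤s (s≤s z≤n)
  restrictPosition-valid (suc (suc i)) (x ∷ xs) e with p x | restrictPosition (suc i) xs in e′
  ... | true | just k = s≤s z≤n , s≤s (proj₂ (restrictPosition-valid (suc i) xs e′))
  ... | false | _ = s≤s z≤n , s≤s (proj₂ (restrictPosition-valid (suc i) xs (trans e′ e)))

  restrictPosition-keep-valid : ∀ r xs {k} → restrictPosition r xs ≡ just k →
    1 ≤ suc k × suc k < length (keep xs)
  restrictPosition-keep-valid (suc zero) (x ∷ y ∷ xs) e with p x | p y
  restrictPosition-keep-valid (suc zero) (x ∷ y ∷ xs) refl | true | true = s≤s z≤n , s≤s (s≤s z≤n)
  restrictPosition-keep-valid (suc zero) (x ∷ y ∷ xs) () | true | false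
  restrictPosition-keep-valid (suc zero) (x ∷ y ∷ xs) () | false | _
  restrictPosition-keep-valid (suc (suc i)) (x ∷ xs) e with p x | restrictPosition (suc i) xs in e′
  restrictPosition-keep-valid (suc (suc i)) (x ∷ xs) refl | true | just k =
    s≤s z≤n , s≤s (proj₂ (restrictPosition-keep-valid (suc i) xs e′))
  ... | false | _ = restrictPosition-keep-valid (suc i) xs (trans e′ e)

  length-keep-swapAt : ∀ r xs → length (keep (swapAt r xs)) ≡ length (keep xs)
  length-keep-swapAt r xs with restrictPosition r xs in e
  ... | just k = trans (cong length (keep-swapAt-kept r xs e)) (length-swapAt (suc k) (keep xs))
  ... | nothing = cong length (keep-swapAt-dropped r xs e)

  restrict : List ℕ → List ℕ → List ℕ
  restrict σ [] = []
  restrict σ (r ∷ w) with restrictPosition r σ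
  ... | just k = suc k ∷ restrict (swapAt r σ) w
  ... | nothing = restrict (swapAt r σ) w

  evalFrom-restrict : ∀ σ w → evalFrom (keep σ) (restrict σ w) ≡ keep (evalFrom σ w)
  evalFrom-restrict σ [] = refl
  evalFrom-restrict σ (r ∷ w) with restrictPosition r σ in e
  ... | just k rewrite sym (keep-swapAt-kept r σ e) = evalFrom-restrict (swapAt r σ) w
  ... | nothing rewrite sym (keep-swapAt-dropped r σ e) = evalFrom-restrict (swapAt r σ) w

  restrict-valid : ∀ σ w → ValidWord (length (keep σ)) (restrict σ w)
  restrict-valid-swapAt : ∀ r σ w → ValidWord (length (keep σ)) (restrict (swapAt r σ) w)

  restrict-valid σ [] = []
  restrict-valid σ (r ∷ w) with restrictPosition r σ in e
  ... | just k = restrictPosition-keep-valid r σ e ∷ restrict-valid-swapAt r σ w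
  ... | nothing = restrict-valid-swapAt r σ w

  restrict-valid-swapAt r σ w =
    subst (λ n → ValidWord n (restrict (swapAt r σ) w)) (length-keep-swapAt r σ) (restrict-valid (swapAt r σ) w)

  length-restrict : ∀ σ w → length (restrict σ w) ≤ length w
  length-restrict σ [] = z≤n
  length-restrict σ (r ∷ w) with restrictPosition r σ
  ... | just k = s≤s (length-restrict (swapAt r σ) w)
  ... | nothing = m≤n⇒m≤1+n (length-restrict (swapAt r σ) w)

  data AllKept : List ℕ → List ℕ → Set where
    []  : ∀ {σ} → AllKept σ []
    _∷_ : ∀ {σ r w k} → restrictPosition r σ ≡ just k → AllKept (swapAt r σ) w → AllKept σ (r ∷ w)

  length-restrict≡⇒AllKept : ∀ σ w → length (restrict σ w) ≡ length w → AllKept σ w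
  length-restrict≡⇒AllKept σ [] _ = []
  length-restrict≡⇒AllKept σ (r ∷ w) eq with restrictPosition r σ in e
  ... | just k = e ∷ length-restrict≡⇒AllKept (swapAt r σ) w (suc-injective eq)
  ... | nothing = ⊥-elim (<-irrefl eq (s≤s (length-restrict (swapAt r σ) w)))

  restrictPosition-dropped : ∀ r {L} → Dropped L → restrictPosition r L ≡ nothing
  restrictPosition-dropped zero _ = refl
  restrictPosition-dropped (suc zero) [] = refl
  restrictPosition-dropped (suc zero) (_ ∷ []) = refl
  restrictPosition-dropped (suc zero) {x ∷ y ∷ L} (¬px ∷ _) with p x
  ... | true = ⊥-elim (¬px tt)
  ... | false = refl
  restrictPosition-dropped (suc (suc i)) [] = refl
  restrictPosition-dropped (suc (suc i)) {x ∷ L} (¬px ∷ ¬pL) with p x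
  ... | true = ⊥-elim (¬px tt)
  ... | false = restrictPosition-dropped (suc i) ¬pL

  restrictPosition-++ˡ : ∀ r xs {L k} → Dropped L →
    restrictPosition r (xs ++ L) ≡ just k → restrictPosition r xs ≡ just k
  restrictPosition-++ˡ r [] ¬pL e with () ← trans (sym e) (restrictPosition-dropped r ¬pL)
  restrictPosition-++ˡ (suc zero) (x ∷ []) {y ∷ L} (¬py ∷ _) e with p x | p y
  ... | _ | true = ⊥-elim (¬py tt)
  restrictPosition-++ˡ (suc zero) (x ∷ []) {y ∷ L} _ () | true | false
  restrictPosition-++ˡ (suc zero) (x ∷ []) {y ∷ L} _ () | false | false
  restrictPosition-++ˡ (suc zero) (x ∷ y ∷ xs) _ e = e
  restrictPosition-++ˡ (suc (suc i)) (x ∷ xs) {L} ¬pL e with p x | restrictPosition (suc i) (xs ++ L) in e′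
  ... | true | just k rewrite restrictPosition-++ˡ (suc i) xs ¬pL e′ = e
  ... | false | _ = restrictPosition-++ˡ (suc i) xs ¬pL (trans e′ e)

  restrictPosition-++ʳ : ∀ r S {ys k} → Dropped S → restrictPosition r (S ++ ys) ≡ just k →
    ∃[ r′ ] (r ≡ r′ + length S × restrictPosition r′ ys ≡ just k)
  restrictPosition-++ʳ r [] _ e = r , sym (+-identityʳ r) , e
  restrictPosition-++ʳ (suc zero) (x ∷ S) {ys} (¬px ∷ _) e with S ++ ys
  restrictPosition-++ʳ (suc zero) (x ∷ S) (¬px ∷ _) () | []
  ... | _ ∷ _ with p x
  ... | true = ⊥-elim (¬px tt)
  restrictPosition-++ʳ (suc zero) (x ∷ S) (¬px ∷ _) () | _ ∷ _ | false
  restrictPosition-++ʳ (suc (suc i)) (x ∷ S) (¬px ∷ ¬pS) e with p x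
  ... | true = ⊥-elim (¬px tt)
  ... | false with restrictPosition-++ʳ (suc i) S ¬pS e
  ...   | r′ , i≡ , e′ = r′ , trans (cong suc i≡) (sym (+-suc r′ (length S))) , e′

  AllKept-++ˡ : ∀ xs {L w} → Dropped L → AllKept (xs ++ L) w → ValidWord (length xs) w
  AllKept-++ˡ xs ¬pL [] = []
  AllKept-++ˡ xs {L} {r ∷ w} ¬pL (e ∷ kept) =
    valid ∷ subst (λ n → ValidWord n w) (length-swapAt r xs)
              (AllKept-++ˡ (swapAt r xs) ¬pL (subst (λ σ → AllKept σ w) (swapAt-++ˡ xs L (proj₂ valid)) kept))
    where
    valid : 1 ≤ r × r < length xs
    valid = restrictPosition-valid r xs (restrictPosition-++ˡ r xs ¬pL e)

  AllKept-++ʳ : ∀ S {ys w} → Dropped S → AllKept (S ++ ys) w →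
    ∃[ v ] (w ≡ map (_+ length S) v × ValidWord (length ys) v)
  AllKept-++ʳ S ¬pS [] = [] , refl , []
  AllKept-++ʳ S {ys} {r ∷ w} ¬pS (e ∷ kept) with restrictPosition-++ʳ r S ¬pS e
  ... | r′ , refl , e′ with restrictPosition-valid r′ ys e′
  ... | valid@(s≤s z≤n , _)
      with AllKept-++ʳ S ¬pS (subst (λ σ → AllKept σ w) (swapAt-++ʳ _ S ys) kept)
  ... | v , refl , valid-v = r′ ∷ v , refl , valid ∷ subst (λ n → ValidWord n v) (length-swapAt r′ ys) valid-v

record ReducedWordCorrespondence (α π : List ℕ) : Set where
  field
    embed           : List ℕ → List ℕ
    embed-injective : ∀ {u v} → embed u ≡ embed v → u ≡ v
    Reduced⁺        : ∀ {v} → Reduced α v → Reduced π (embed v)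
    Reduced⁻        : ∀ {w} → Reduced π w → ∃[ v ] (w ≡ embed v × Reduced α v)
    Move⁺           : ∀ {u v} → Move u v → Move (embed u) (embed v)
    Move⁻           : ∀ {u v} → Move (embed u) (embed v) → Move u v

  Reduced-embed⁻ : ∀ {u} → Reduced π (embed u) → Reduced α u
  Reduced-embed⁻ ru with Reduced⁻ ru
  ... | _ , e , ru′ with embed-injective e
  ... | refl = ru′

  Walk⁺ : ∀ {u v k} → Walk α u v k → Walk π (embed u) (embed v) k
  Walk⁺ here = here
  Walk⁺ (step ru rv m walk) = step (Reduced⁺ ru) (Reduced⁺ rv) (Move⁺ m) (Walk⁺ walk)

  Walk⁻ : ∀ {x y k} → Walk π x y k → ∀ {u v} → x ≡ embed u → y ≡ embed v → Walk α u v k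
  Walk⁻ here refl y≡ with embed-injective y≡
  ... | refl = here
  Walk⁻ (step rx rx′ m walk) refl y≡ with Reduced⁻ rx′
  ... | _ , refl , rv′ = step (Reduced-embed⁻ rx) rv′ (Move⁻ m) (Walk⁻ walk refl y≡)

  HasDiameter⇔ : ∀ d → HasDiameter π d ⇔ HasDiameter α d
  HasDiameter⇔ d = mk⇔ to from
    where
    to : HasDiameter π d → HasDiameter α d
    to (bounded , x , y , rx , ry , far) with Reduced⁻ rx | Reduced⁻ ry
    ... | u , refl , ru | v , refl , rv = bounded′ , u , v , ru , rv , λ k walk → far k (Walk⁺ walk)
      where
      bounded′ : ∀ u′ v′ → Reduced α u′ → Reduced α v′ → ∃[ k ] (k ≤ d × Walk α u′ v′ k)
      bounded′ u′ v′ ru′ rv′ with bounded _ _ (Reduced⁺ ru′) (Reduced⁺ rv′)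
      ... | k , k≤d , walk = k , k≤d , Walk⁻ walk refl refl

    from : HasDiameter α d → HasDiameter π d
    from (bounded , u , v , ru , rv , far) =
      bounded′ , embed u , embed v , Reduced⁺ ru , Reduced⁺ rv , λ k walk → far k (Walk⁻ walk refl refl)
      where
      bounded′ : ∀ x y → Reduced π x → Reduced π y → ∃[ k ] (k ≤ d × Walk π x y k)
      bounded′ x y rx ry with Reduced⁻ rx | Reduced⁻ ry
      ... | u′ , refl , ru′ | v′ , refl , rv′ with bounded u′ v′ ru′ rv′
      ... | k , k≤d , walk = k , k≤d , Walk⁺ walk

module EmbedProject {α π : List ℕ} (embed project : List ℕ → List ℕ)
  (length-embed : ∀ v → length (embed v) ≡ length v)
  (length-project : ∀ w → length (project w) ≤ length w)
  (IsWord-embed : ∀ {v} → IsWord α v → IsWord π (embed v))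
  (IsWord-project : ∀ {w} → IsWord π w → IsWord α (project w)) where

  Reduced-embed : ∀ {v} → Reduced α v → Reduced π (embed v)
  Reduced-embed {v} (word , minimal) = IsWord-embed word , λ u word-u → begin
    length (embed v)    ≡⟨ length-embed v ⟩
    length v            ≤⟨ minimal _ (IsWord-project word-u) ⟩
    length (project u)  ≤⟨ length-project u ⟩
    length u            ∎
    where open ≤-Reasoning

  Reduced⇒length-project : ∀ {w} → Reduced π w → length (project w) ≡ length w
  Reduced⇒length-project {w} (word , minimal) = ≤-antisym (length-project w) (begin
    length w                      ≤⟨ minimal _ (IsWord-embed (IsWord-project word)) ⟩
    length (embed (project w))    ≡⟨ length-embed (project w) ⟩
    length (project w)            ∎)
    where open ≤-Reasoning

  Reduced-unembed : ∀ {v} → IsWord α v → Reduced π (embed v) → Reduced α v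
  Reduced-unembed {v} word (_ , minimal) = word , λ u word-u → begin
    length v            ≡⟨ length-embed v ⟨
    length (embed v)    ≤⟨ minimal _ (IsWord-embed word-u) ⟩
    length (embed u)    ≡⟨ length-embed u ⟩
    length u            ∎
    where open ≤-Reasoning

module Shift (b : ℕ) where

  shift : List ℕ → List ℕ
  shift = map (_+ b)

  shift-injective : ∀ {u v} → shift u ≡ shift v → u ≡ v
  shift-injective = map-injective (+-cancelʳ-≡ b _ _)

  ∣-∣-shift : ∀ j k → ∣ j + b - k + b ∣ ≡ ∣ j - k ∣
  ∣-∣-shift j k = trans (cong₂ ∣_-_∣ (+-comm j b) (+-comm k b)) (∣m+n-m+o∣≡∣n-o∣ b j k)

  shift-++⁻ : ∀ u {xs ys} → shift u ≡ xs ++ ys →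
    ∃[ u₁ ] ∃[ u₂ ] (u ≡ u₁ ++ u₂ × shift u₁ ≡ xs × shift u₂ ≡ ys)
  shift-++⁻ u {[]} e = [] , u , refl , refl , e
  shift-++⁻ (x ∷ u) {_ ∷ xs} e with ∷-injectiveˡ e | shift-++⁻ u {xs} (∷-injectiveʳ e)
  ... | refl | u₁ , u₂ , refl , refl , e′ = x ∷ u₁ , u₂ , refl , refl , e′

  ValidWord-shift : ∀ {n w} → ValidWord n w → ValidWord (b + n) (shift w)
  ValidWord-shift {n} = map⁺ ∘ All.map (λ {r} (1≤r , r<n) →
    ≤-trans 1≤r (m≤m+n r b) , subst (_< b + n) (+-comm b r) (+-monoʳ-< b r<n))

  Move-shift : ∀ {u v} → Move u v → Move (shift u) (shift v)
  Move-shift (comm p q j k gap) rewrite map-++ (_+ b) p (j ∷ k ∷ q) | map-++ (_+ b) p (k ∷ j ∷ q) =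
    comm (shift p) (shift q) (j + b) (k + b) (subst (1 <_) (sym (∣-∣-shift j k)) gap)
  Move-shift (braidL p q j) rewrite map-++ (_+ b) p (j ∷ suc j ∷ j ∷ q) | map-++ (_+ b) p (suc j ∷ j ∷ suc j ∷ q) =
    braidL (shift p) (shift q) (j + b)
  Move-shift (braidR p q j) rewrite map-++ (_+ b) p (suc j ∷ j ∷ suc j ∷ q) | map-++ (_+ b) p (j ∷ suc j ∷ j ∷ q) =
    braidR (shift p) (shift q) (j + b)

  Move-unshift′ : ∀ {x y} → Move x y → ∀ u → shift u ≡ x → ∃[ v ] (shift v ≡ y × Move u v)
  Move-unshift′ (comm p q j k gap) u e with shift-++⁻ u {p} e
  ... | u₁ , j′ ∷ k′ ∷ q′ , refl , refl , refl =
    u₁ ++ k′ ∷ j′ ∷ q′ , map-++ (_+ b) u₁ _ , comm u₁ q′ j′ k′ (subst (1 <_) (∣-∣-shift j′ k′) gap)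
  Move-unshift′ (braidL p q j) u e with shift-++⁻ u {p} e
  ... | u₁ , u₂@(j′ ∷ _ ∷ _ ∷ q′) , refl , refl , e₂
      with ∷-injectiveˡ e₂ | ∷-injectiveʳ (∷-injectiveʳ (∷-injectiveʳ e₂))
  ... | refl | refl with shift-injective {u₂} {j′ ∷ suc j′ ∷ j′ ∷ q′} e₂
  ... | refl = u₁ ++ suc j′ ∷ j′ ∷ suc j′ ∷ q′ , map-++ (_+ b) u₁ _ , braidL u₁ q′ j′
  Move-unshift′ (braidR p q j) u e with shift-++⁻ u {p} e
  ... | u₁ , u₂@(_ ∷ j′ ∷ _ ∷ q′) , refl , refl , e₂
      with ∷-injectiveˡ (∷-injectiveʳ e₂) | ∷-injectiveʳ (∷-injectiveʳ (∷-injectiveʳ e₂))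
  ... | refl | refl with shift-injective {u₂} {suc j′ ∷ j′ ∷ suc j′ ∷ q′} e₂
  ... | refl = u₁ ++ j′ ∷ suc j′ ∷ j′ ∷ q′ , map-++ (_+ b) u₁ _ , braidR u₁ q′ j′

  Move-unshift : ∀ {u v} → Move (shift u) (shift v) → Move u v
  Move-unshift {u} m with Move-unshift′ m u refl
  ... | _ , e , m′ with shift-injective e
  ... | refl = m′

module AppendIdentity {α : List ℕ} (perm : IsPerm α) (b : ℕ) where

  private
    a = length α
    L = map (_+ a) (ι b)
    π = α ⊕ ι b
    σ = ι (length π)

  open Restriction (_≤ᵇ a)

  kept-α : All (T ∘ (_≤ᵇ a)) α
  kept-α = All.map (λ (_ , x≤a) → ≤⇒≤ᵇ x≤a) (IsPerm⇒bounds perm)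

  kept-ι : All (T ∘ (_≤ᵇ a)) (ι a)
  kept-ι = All.map (λ (_ , x≤a) → ≤⇒≤ᵇ x≤a) (ι-bounds a)

  dropped-L : Dropped L
  dropped-L = map⁺ (All.map (λ (1≤x , _) t → <⇒≱ (m<n+m a 1≤x) (≤ᵇ⇒≤ _ a t)) (ι-bounds b))

  length-π : length π ≡ a + b
  length-π = trans (length-++ α) (cong (a +_) (trans (length-map _ (ι b)) (length-ι b)))

  σ≡ : σ ≡ ι a ++ L
  σ≡ = trans (cong ι length-π) (ι-+ a b)

  keep-σ : keep σ ≡ ι a
  keep-σ = begin
    keep σ              ≡⟨ cong keep σ≡ ⟩
    keep (ι a ++ L)     ≡⟨ keep-++ (ι a) L ⟩
    keep (ι a) ++ keep L ≡⟨ cong₂ _++_ (keep-all kept-ι) (keep-none dropped-L) ⟩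
    ι a ++ []           ≡⟨ ++-identityʳ (ι a) ⟩
    ι a                 ∎
    where open ≡-Reasoning

  keep-π : keep π ≡ α
  keep-π = begin
    keep (α ++ L)       ≡⟨ keep-++ α L ⟩
    keep α ++ keep L    ≡⟨ cong₂ _++_ (keep-all kept-α) (keep-none dropped-L) ⟩
    α ++ []             ≡⟨ ++-identityʳ α ⟩
    α                   ∎
    where open ≡-Reasoning

  evalFrom-σ : ∀ {v} → ValidWord a v → evalFrom σ v ≡ evalFrom (ι a) v ++ L
  evalFrom-σ {v} valid = trans (cong (λ s → evalFrom s v) σ≡)
    (evalFrom-++ˡ (ι a) L v (subst (λ n → ValidWord n v) (sym (length-ι a)) valid))

  IsWord-lift : ∀ {v} → IsWord α v → IsWord π v
  IsWord-lift (valid , eval) =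
    ValidWord-mono (subst (a ≤_) (sym length-π) (m≤m+n a b)) valid ,
    trans (evalFrom-σ valid) (cong (_++ L) eval)

  IsWord-restrict : ∀ {w} → IsWord π w → IsWord α (restrict σ w)
  IsWord-restrict {w} (_ , eval) =
    subst (λ n → ValidWord n (restrict σ w)) (trans (cong length keep-σ) (length-ι a)) (restrict-valid σ w) ,
    (begin
      evalFrom (ι a) (restrict σ w)      ≡⟨ cong (λ s → evalFrom s (restrict σ w)) keep-σ ⟨
      evalFrom (keep σ) (restrict σ w)   ≡⟨ evalFrom-restrict σ w ⟩
      keep (evalFrom σ w)                ≡⟨ cong keep eval ⟩
      keep π                             ≡⟨ keep-π ⟩
      α                                  ∎)
    where open ≡-Reasoning

  open EmbedProject id (restrict σ) (λ _ → refl) (length-restrict σ) IsWord-lift IsWord-restrict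

  Reduced-onto : ∀ {w} → Reduced π w → ∃[ v ] (w ≡ v × Reduced α v)
  Reduced-onto {w} red@((_ , eval) , _) = w , refl , Reduced-unembed (valid , ++-cancelʳ L _ _ eval′) red
    where
    kept : AllKept (ι a ++ L) w
    kept = subst (λ s → AllKept s w) σ≡ (length-restrict≡⇒AllKept σ w (Reduced⇒length-project red))
    valid : ValidWord a w
    valid = subst (λ n → ValidWord n w) (length-ι a) (AllKept-++ˡ (ι a) dropped-L kept)
    eval′ : evalFrom (ι a) w ++ L ≡ α ++ L
    eval′ = trans (sym (evalFrom-σ valid)) eval

  correspondence : ReducedWordCorrespondence α π
  correspondence = record
    { embed = id ; embed-injective = id ; Reduced⁺ = Reduced-embed ; Reduced⁻ = Reduced-onto
    ; Move⁺ = id ; Move⁻ = id }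

module PrependIdentity {α : List ℕ} (perm : IsPerm α) (b : ℕ) where

  open Shift b

  private
    a = length α
    Y = shift (ι a)
    π = ι b ++ shift α
    σ = ι (length π)

  open Restriction (b <ᵇ_)

  kept-shift : ∀ {xs} → All (λ x → 1 ≤ x × x ≤ a) xs → All (T ∘ (b <ᵇ_)) (shift xs)
  kept-shift bounds = map⁺ (All.map (λ (1≤x , _) → <⇒<ᵇ (m<n+m b 1≤x)) bounds)

  dropped-ι : Dropped (ι b)
  dropped-ι = All.map (λ (_ , x≤b) t → <⇒≱ (<ᵇ⇒< b _ t) x≤b) (ι-bounds b)

  length-Y : length Y ≡ a
  length-Y = trans (length-map _ (ι a)) (length-ι a)

  length-π : length π ≡ b + a
  length-π = trans (length-++ (ι b)) (cong₂ _+_ (length-ι b) (length-map _ α))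

  σ≡ : σ ≡ ι b ++ Y
  σ≡ = trans (cong ι length-π) (ι-+ b a)

  keep-σ : keep σ ≡ Y
  keep-σ = trans (cong keep σ≡) (trans (keep-++ (ι b) Y)
                 (cong₂ _++_ (keep-none dropped-ι) (keep-all (kept-shift (ι-bounds a)))))

  keep-π : keep π ≡ shift α
  keep-π = trans (keep-++ (ι b) _) (cong₂ _++_ (keep-none dropped-ι) (keep-all (kept-shift (IsPerm⇒bounds perm))))

  shift-by-length-ι : ∀ v → map (_+ length (ι b)) v ≡ shift v
  shift-by-length-ι v = cong (λ c → map (_+ c) v) (length-ι b)

  evalFrom-σ : ∀ {v} → ValidWord a v → evalFrom σ (shift v) ≡ ι b ++ shift (evalFrom (ι a) v)
  evalFrom-σ {v} valid = begin
    evalFrom σ (shift v)                           ≡⟨ cong₂ evalFrom σ≡ (sym (shift-by-length-ι v)) ⟩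
    evalFrom (ι b ++ Y) (map (_+ length (ι b)) v)  ≡⟨ evalFrom-++ʳ (ι b) Y v valid-Y ⟩
    ι b ++ evalFrom Y v                            ≡⟨ cong (ι b ++_) (evalFrom-map (_+ b) (ι a) v) ⟩
    ι b ++ shift (evalFrom (ι a) v)                ∎
    where
    open ≡-Reasoning
    valid-Y : ValidWord (length Y) v
    valid-Y = subst (λ n → ValidWord n v) (sym length-Y) valid

  IsWord-lift : ∀ {v} → IsWord α v → IsWord π (shift v)
  IsWord-lift {v} (valid , eval) =
    subst (λ n → ValidWord n (shift v)) (sym length-π) (ValidWord-shift valid) ,
    trans (evalFrom-σ valid) (cong (λ s → ι b ++ shift s) eval)

  IsWord-restrict : ∀ {w} → IsWord π w → IsWord α (restrict σ w)
  IsWord-restrict {w} (_ , eval) =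
    subst (λ n → ValidWord n (restrict σ w)) (trans (cong length keep-σ) length-Y) (restrict-valid σ w) ,
    shift-injective (begin
      shift (evalFrom (ι a) (restrict σ w))  ≡⟨ evalFrom-map (_+ b) (ι a) (restrict σ w) ⟨
      evalFrom Y (restrict σ w)              ≡⟨ cong (λ s → evalFrom s (restrict σ w)) keep-σ ⟨
      evalFrom (keep σ) (restrict σ w)       ≡⟨ evalFrom-restrict σ w ⟩
      keep (evalFrom σ w)                    ≡⟨ cong keep eval ⟩
      keep π                                 ≡⟨ keep-π ⟩
      shift α                                ∎)
    where open ≡-Reasoning

  open EmbedProject shift (restrict σ) (length-map _) (length-restrict σ) IsWord-lift IsWord-restrict

  Reduced-onto : ∀ {w} → Reduced π w → ∃[ v ] (w ≡ shift v × Reduced α v)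
  Reduced-onto {w} red@((_ , eval) , _)
    with AllKept-++ʳ (ι b) dropped-ι (subst (λ s → AllKept s w) σ≡
           (length-restrict≡⇒AllKept σ w (Reduced⇒length-project red)))
  ... | v , w≡ , valid-Y = v , w≡′ , Reduced-unembed (valid , eval′) (subst (Reduced π) w≡′ red)
    where
    w≡′ : w ≡ shift v
    w≡′ = trans w≡ (shift-by-length-ι v)
    valid : ValidWord a v
    valid = subst (λ n → ValidWord n v) length-Y valid-Y
    eval′ : evalFrom (ι a) v ≡ α
    eval′ = shift-injective (++-cancelˡ (ι b) _ _
              (trans (sym (evalFrom-σ valid)) (trans (cong (evalFrom σ) (sym w≡′)) eval)))

  correspondence′ : ReducedWordCorrespondence α π
  correspondence′ = record
    { embed = shift ; embed-injective = shift-injective ; Reduced⁺ = Reduced-embed ; Reduced⁻ = Reduced-onto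
    ; Move⁺ = Move-shift ; Move⁻ = Move-unshift }

  correspondence : ReducedWordCorrespondence α (ι b ⊕ α)
  correspondence = subst (ReducedWordCorrespondence α) (cong (ι b ++_) (sym (shift-by-length-ι α))) correspondence′

lemma6p12 : (α : List ℕ) → IsPerm α → (b d : ℕ) →
    (HasDiameter (α ⊕ ι b) d ⇔ HasDiameter α d) ×
    (HasDiameter (ι b ⊕ α) d ⇔ HasDiameter α d)
lemma6p12 α perm b d =
  ReducedWordCorrespondence.HasDiameter⇔ (AppendIdentity.correspondence perm b) d ,
  ReducedWordCorrespondence.HasDiameter⇔ (PrependIdentity.correspondence perm b) d
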